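{- Let $\mathbf{M}=(M;\leq,0,1)$ be a non-trivial complete lattice (so $0\neq 1$), let $S$ be a non-empty set, and let $\mathbf{A}$ and $\mathbf{B}$ be bounded subposets of $\mathbf{M}^{S}$. Then: (a) If $R_1\subseteq R_2\subseteq S\times S$, then $T_{R_2}\leq T_{R_1}$ and $P_{R_1}\leq P_{R_2}$. (b) If $T_1,T_2\colon B\to M^{S}$ are order-preserving mappings such that $T_2\leq T_1$ and $T_2(1)=T_1(1)=1$, then $R_{T_1}\subseteq R_{T_2}$. (c) If $P_1,P_2\colon A\to M^{S}$ are order-preserving mappings such that $P_1\leq P_2$ and $P_1(0)=P_2(0)=0$, then $R^{P_1}\subseteq R^{P_2}$. (d) If $R\subseteq S\times S$, then $R\subseteq R_{T_R}\cap R^{P_R}$. (e) If $T\colon B\to M^{S}$ is an order-preserving mapping with $T(1)=1$, then $T\leq T_{R_T}$. (f) If $P\colon A\to M^{S}$ is an order-preserving mapping with $P(0)=0$, then $P_{R^{P}}\leq P$. (g) $R_{T_{S\times S}}=S\times S$, $R_{T_{\emptyset}}=\emptyset$, $R^{P_{S\times S}}=S\times S$ and $R^{P_{\emptyset}}=\emptyset$; i.e., both extremal relations $S\times S$ and $\emptyset$ are recoverable from the corresponding upper and from the corresponding lower transition operators.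
   Context: $\mathbf{M}^S$ is ordered componentwise; a bounded subposet of $\mathbf{M}^S$ is a subset containing the constant tuples $0=(0)_{s\in S}$ and $1=(1)_{s\in S}$ with the inherited order. For $s\in S$ and $m=(m_u)_{u\in S}\in M^S$ write $s(m)=m_s$. For maps $f,g$ into a poset, $f\leq g$ means $f(x)\leq g(x)$ for all $x$. For a relation $R\subseteq S\times S$ (writing $sRt$ for $(s,t)\in R$), the upper transition operator $T_R\colon B\to M^S$ is defined by $T_R(b)(s)=\bigwedge_M\{t(b)\mid sRt\}$ for $b\in B$, $s\in S$, and the lower transition operator $P_R\colon A\to M^S$ by $P_R(a)(t)=\bigvee_M\{s(a)\mid sRt\}$ for $a\in A$, $t\in S$ (empty meet is $1$, empty join is $0$). For a map $T\colon B\to M^S$ define $R_T=\{(s,t)\in S\times S\mid \forall b\in B:\ s(T(b))\leq t(b)\}$, and for a map $P\colon A\to M^S$ define $R^{P}=\{(s,t)\in S\times S\mid \forall a\in A:\ s(a)\leq t(P(a))\}$. A relation $R$ is recoverable from $T_R$ if $R=R_{T_R}$ and recoverable from $P_R$ if $R=R^{P_R}$. -}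

module Defs where

open import Level using (0ℓ)
open import Data.Product using (Σ; _,_; proj₁; proj₂)
open import Data.Empty using (⊥)
open import Relation.Binary.Core using (Rel)
open import Relation.Binary.Bundles using (Poset)

-- A complete lattice: a poset (with setoid equality _≈_) in which every
-- family indexed by a (small) type has a greatest lower bound ⋀ and a
-- least upper bound ⋁.  (The meet/join of a subset is the meet/join of
-- the family enumerating it.)
record CompleteLattice : Set₁ where
  field
    poset : Poset 0ℓ 0ℓ 0ℓ
  open Poset poset public
  field
    ⋀          : {I : Set} → (I → Carrier) → Carrier
    ⋀-lower    : {I : Set} (f : I → Carrier) (i : I) → ⋀ f ≤ f i
    ⋀-greatest : {I : Set} (f : I → Carrier) (x : Carrier) →
                 (∀ i → x ≤ f i) → x ≤ ⋀ f
    ⋁          : {I : Set} → (I → Carrier) → Carrier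
    ⋁-upper    : {I : Set} (f : I → Carrier) (i : I) → f i ≤ ⋁ f
    ⋁-least    : {I : Set} (f : I → Carrier) (x : Carrier) →
                 (∀ i → f i ≤ x) → ⋁ f ≤ x

  𝟎 : Carrier
  𝟎 = ⋁ {⊥} (λ ())

  𝟏 : Carrier
  𝟏 = ⋀ {⊥} (λ ())

module Ops (M : CompleteLattice) (S : Set) where
  open CompleteLattice M

  MS : Set
  MS = S → Carrier

  _≤ˢ_ : MS → MS → Set
  f ≤ˢ g = ∀ s → f s ≤ g s

  _≈ˢ_ : MS → MS → Set
  f ≈ˢ g = ∀ s → f s ≈ g s

  0ˢ : MS
  0ˢ = λ _ → 𝟎

  1ˢ : MS
  1ˢ = λ _ → 𝟏

  -- a bounded subposet of M^S: a subset containing 0 and 1 (inherited order)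
  record BoundedSubposet : Set₁ where
    field
      mem  : MS → Set
      has0 : mem 0ˢ
      has1 : mem 1ˢ

  Elem : BoundedSubposet → Set
  Elem X = Σ MS (BoundedSubposet.mem X)

  ⟨0⟩ : (X : BoundedSubposet) → Elem X
  ⟨0⟩ X = 0ˢ , BoundedSubposet.has0 X

  ⟨1⟩ : (X : BoundedSubposet) → Elem X
  ⟨1⟩ X = 1ˢ , BoundedSubposet.has1 X

  _≤ᴹ_ : {X : BoundedSubposet} → (Elem X → MS) → (Elem X → MS) → Set
  F ≤ᴹ G = ∀ x → F x ≤ˢ G x

  OrderPreserving : {X : BoundedSubposet} → (Elem X → MS) → Set
  OrderPreserving F = ∀ x y → proj₁ x ≤ˢ proj₁ y → F x ≤ˢ F y

  T[_] : Rel S 0ℓ → (B : BoundedSubposet) → Elem B → MS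
  T[ R ] B b s = ⋀ {Σ S (λ t → R s t)} (λ p → proj₁ b (proj₁ p))

  P[_] : Rel S 0ℓ → (A : BoundedSubposet) → Elem A → MS
  P[ R ] A a t = ⋁ {Σ S (λ s → R s t)} (λ p → proj₁ a (proj₁ p))

  R[_]_ : (B : BoundedSubposet) → (Elem B → MS) → Rel S 0ℓ
  R[ B ] T = λ s t → ∀ (b : Elem B) → T b s ≤ proj₁ b t

  Rᵘ[_]_ : (A : BoundedSubposet) → (Elem A → MS) → Rel S 0ℓ
  Rᵘ[ A ] P = λ s t → ∀ (a : Elem A) → proj₁ a s ≤ P a t

module Submission where

-- Proof idea.  Fix a complete lattice M and a set S.  Both pairs of
-- operators form antitone Galois correspondences between relations on S
-- and maps X → M^S:
--
--     R ⊆ R_T   ⇔   T ≤ T_R          R ⊆ R^P   ⇔   P_R ≤ P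
--
-- since T ≤ T_R unfolds to "T(b)(s) ≤ t(b) whenever s R t", which is the
-- definition of R ⊆ R_T (dually for P).  Instantiating the correspondences
-- at T = T_R, P = P_R and at R = R_T, R = R^P gives the closure
-- properties (d), (e), (f).  Parts (a)-(c) are the monotonicity of the
-- four operators, proved directly from the universal properties of ⋀ and
-- ⋁.  For (g), the full relation is recovered by (d); the empty relation
-- is recovered because T_∅ is constantly 1 and P_∅ constantly 0, so that
-- s R_{T_∅} t would give 1 ≤ t(0) = 0, contradicting non-triviality of M.

open import Defs
open import Level using (0ℓ)
open import Data.Product using (_×_; _,_)
open import Data.Empty using (⊥-elim)
open import Relation.Nullary using (¬_)
open import Relation.Binary.Core using (Rel; _⇒_; _⇔_)
open import Relation.Binary.Construct.Intersection using (_∩_)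
open import Relation.Binary.Construct.Always using (Always)
open import Relation.Binary.Construct.Never using (Never)

module TransitionOperators (M : CompleteLattice) (S : Set) where
  open CompleteLattice M
  open Ops M S

  -- (a) Enlarging the relation enlarges the index set of the meet defining
  -- T_R and of the join defining P_R.
  T-antitone : (B : BoundedSubposet) {R₁ R₂ : Rel S 0ℓ} →
               R₁ ⇒ R₂ → _≤ᴹ_ {B} (T[ R₂ ] B) (T[ R₁ ] B)
  T-antitone B R₁⇒R₂ b s =
    ⋀-greatest _ _ (λ { (t , sR₁t) → ⋀-lower _ (t , R₁⇒R₂ sR₁t) })

  P-monotone : (A : BoundedSubposet) {R₁ R₂ : Rel S 0ℓ} →
               R₁ ⇒ R₂ → _≤ᴹ_ {A} (P[ R₁ ] A) (P[ R₂ ] A)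
  P-monotone A R₁⇒R₂ a t =
    ⋁-least _ _ (λ { (s , sR₁t) → ⋁-upper _ (s , R₁⇒R₂ sR₁t) })

  -- (b), (c) Shrinking T (enlarging P) weakens the defining inequalities.
  R-antitone : (B : BoundedSubposet) {T₁ T₂ : Elem B → MS} →
               _≤ᴹ_ {B} T₂ T₁ → (R[ B ] T₁) ⇒ (R[ B ] T₂)
  R-antitone B T₂≤T₁ {s} sRt b = trans (T₂≤T₁ b s) (sRt b)

  Rᵘ-monotone : (A : BoundedSubposet) {P₁ P₂ : Elem A → MS} →
                _≤ᴹ_ {A} P₁ P₂ → (Rᵘ[ A ] P₁) ⇒ (Rᵘ[ A ] P₂)
  Rᵘ-monotone A P₁≤P₂ {_} {t} sRt a = trans (sRt a) (P₁≤P₂ a t)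

  ⊆R-to-≤T : (B : BoundedSubposet) (R : Rel S 0ℓ) (T : Elem B → MS) →
             R ⇒ (R[ B ] T) → _≤ᴹ_ {B} T (T[ R ] B)
  ⊆R-to-≤T B R T R⇒R_T b s = ⋀-greatest _ _ (λ { (t , sRt) → R⇒R_T sRt b })

  ≤T-to-⊆R : (B : BoundedSubposet) (R : Rel S 0ℓ) (T : Elem B → MS) →
             _≤ᴹ_ {B} T (T[ R ] B) → R ⇒ (R[ B ] T)
  ≤T-to-⊆R B R T T≤T_R {s} {t} sRt b = trans (T≤T_R b s) (⋀-lower _ (t , sRt))

  ⊆Rᵘ-to-≥P : (A : BoundedSubposet) (R : Rel S 0ℓ) (P : Elem A → MS) →
              R ⇒ (Rᵘ[ A ] P) → _≤ᴹ_ {A} (P[ R ] A) P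
  ⊆Rᵘ-to-≥P A R P R⇒R^P a t = ⋁-least _ _ (λ { (s , sRt) → R⇒R^P sRt a })

  ≥P-to-⊆Rᵘ : (A : BoundedSubposet) (R : Rel S 0ℓ) (P : Elem A → MS) →
              _≤ᴹ_ {A} (P[ R ] A) P → R ⇒ (Rᵘ[ A ] P)
  ≥P-to-⊆Rᵘ A R P P_R≤P {s} {t} sRt a = trans (⋁-upper _ (s , sRt)) (P_R≤P a t)

  R⊆R-T : (B : BoundedSubposet) (R : Rel S 0ℓ) → R ⇒ (R[ B ] (T[ R ] B))
  R⊆R-T B R = ≤T-to-⊆R B R (T[ R ] B) (λ b s → refl)

  R⊆Rᵘ-P : (A : BoundedSubposet) (R : Rel S 0ℓ) → R ⇒ (Rᵘ[ A ] (P[ R ] A))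
  R⊆Rᵘ-P A R = ≥P-to-⊆Rᵘ A R (P[ R ] A) (λ a t → refl)

  T≤T-R : (B : BoundedSubposet) (T : Elem B → MS) → _≤ᴹ_ {B} T (T[ R[ B ] T ] B)
  T≤T-R B T = ⊆R-to-≤T B (R[ B ] T) T (λ sRt → sRt)

  P-Rᵘ≤P : (A : BoundedSubposet) (P : Elem A → MS) → _≤ᴹ_ {A} (P[ Rᵘ[ A ] P ] A) P
  P-Rᵘ≤P A P = ⊆Rᵘ-to-≥P A (Rᵘ[ A ] P) P (λ sRt → sRt)

  1≰0 : ¬ (𝟎 ≈ 𝟏) → ¬ (𝟏 ≤ 𝟎)
  1≰0 0≉1 1≤0 = 0≉1 (antisym (⋁-least _ _ (λ ())) 1≤0)

  -- (g) The empty relation is recovered: T_∅ is the empty meet 1, so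
  -- s R_{T_∅} t evaluated at b = 0 would give 1 ≤ 0.
  R-T-Never : ¬ (𝟎 ≈ 𝟏) → (B : BoundedSubposet) → (R[ B ] (T[ Never ] B)) ⇒ Never {ℓ = 0ℓ}
  R-T-Never 0≉1 B {s} sRt =
    ⊥-elim (1≰0 0≉1 (trans (⋀-greatest _ _ (λ ())) (sRt (⟨0⟩ B))))

  -- Dually P_∅ is the empty join 0, and a = 1 would give 1 ≤ 0.
  Rᵘ-P-Never : ¬ (𝟎 ≈ 𝟏) → (A : BoundedSubposet) → (Rᵘ[ A ] (P[ Never ] A)) ⇒ Never {ℓ = 0ℓ}
  Rᵘ-P-Never 0≉1 A {_} {t} sRt =
    ⊥-elim (1≰0 0≉1 (trans (sRt (⟨1⟩ A)) (⋁-least _ _ (λ ()))))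

lemma2p1 : (M : CompleteLattice) → ¬ (CompleteLattice._≈_ M (CompleteLattice.𝟎 M) (CompleteLattice.𝟏 M)) →
           (S : Set) → S →
           (A B : Ops.BoundedSubposet M S) →
           let open Ops M S in
           -- (a)
           ((R₁ R₂ : Rel S 0ℓ) → R₁ ⇒ R₂ →
              _≤ᴹ_ {B} (T[ R₂ ] B) (T[ R₁ ] B) × _≤ᴹ_ {A} (P[ R₁ ] A) (P[ R₂ ] A))
           -- (b)
           × ((T₁ T₂ : Elem B → MS) → OrderPreserving {B} T₁ → OrderPreserving {B} T₂ →
              _≤ᴹ_ {B} T₂ T₁ → T₂ (⟨1⟩ B) ≈ˢ 1ˢ → T₁ (⟨1⟩ B) ≈ˢ 1ˢ →
              (R[ B ] T₁) ⇒ (R[ B ] T₂))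
           -- (c)
           × ((P₁ P₂ : Elem A → MS) → OrderPreserving {A} P₁ → OrderPreserving {A} P₂ →
              _≤ᴹ_ {A} P₁ P₂ → P₁ (⟨0⟩ A) ≈ˢ 0ˢ → P₂ (⟨0⟩ A) ≈ˢ 0ˢ →
              (Rᵘ[ A ] P₁) ⇒ (Rᵘ[ A ] P₂))
           -- (d)
           × ((R : Rel S 0ℓ) → R ⇒ ((R[ B ] (T[ R ] B)) ∩ (Rᵘ[ A ] (P[ R ] A))))
           -- (e)
           × ((T : Elem B → MS) → OrderPreserving {B} T → T (⟨1⟩ B) ≈ˢ 1ˢ →
              _≤ᴹ_ {B} T (T[ R[ B ] T ] B))
           -- (f)
           × ((P : Elem A → MS) → OrderPreserving {A} P → P (⟨0⟩ A) ≈ˢ 0ˢ →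
              _≤ᴹ_ {A} (P[ Rᵘ[ A ] P ] A) P)
           -- (g)
           × ((R[ B ] (T[ Always ] B)) ⇔ Always {ℓ = 0ℓ})
           × ((R[ B ] (T[ Never ] B)) ⇔ Never {ℓ = 0ℓ})
           × ((Rᵘ[ A ] (P[ Always ] A)) ⇔ Always {ℓ = 0ℓ})
           × ((Rᵘ[ A ] (P[ Never ] A)) ⇔ Never {ℓ = 0ℓ})
lemma2p1 M 0≉1 S _ A B =
    (λ R₁ R₂ R₁⇒R₂ → T-antitone B R₁⇒R₂ , P-monotone A R₁⇒R₂)
  , (λ T₁ T₂ _ _ T₂≤T₁ _ _ → R-antitone B T₂≤T₁)
  , (λ P₁ P₂ _ _ P₁≤P₂ _ _ → Rᵘ-monotone A P₁≤P₂)
  , (λ R sRt → R⊆R-T B R sRt , R⊆Rᵘ-P A R sRt)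
  , (λ T _ _ → T≤T-R B T)
  , (λ P _ _ → P-Rᵘ≤P A P)
  , ((λ _ → _) , λ {s t} → R⊆R-T B Always {s} {t})
  , ((λ {s t} → R-T-Never 0≉1 B {s} {t}) , λ ())
  , ((λ _ → _) , λ {s t} → R⊆Rᵘ-P A Always {s} {t})
  , ((λ {s t} → Rᵘ-P-Never 0≉1 A {s} {t}) , λ ())
  where open TransitionOperators M S
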